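{- Let $\lambda$ be a partition and $\sigma\in\mathcal{F}(\lambda,n)$. Then $\mathrm{cinv}(\sigma)$ equals the number of pairs of cells $(u,v)$ in the same column with $u$ strictly below $v$ such that $\sigma(u)<\sigma(v)<\sigma(w)$, where $w$ is the cell directly to the left of $u$ if it exists; if no such $w$ exists, the condition is only $\sigma(u)<\sigma(v)$.
   Context: Young diagram (Japanese style): cells $(i,j)$ with $1\le j\le\lambda_i$, row $i$ increasing downward, column $j$ increasing to the left (column 1 is rightmost); the cell directly to the left of $(i,j)$ is $(i,j+1)$ and $\mathrm{rt}(i,j)=(i,j-1)$ for $j\ne1$. Cells $u,v$ attack if they are in the same column, or $u=(i,j)$, $v=(k,j-1)$ with $i>k$. $\mathcal{F}(\lambda,n)$ is the set of maps $\sigma$ from cells to $[n]$ with $\sigma(u)\ne\sigma(v)$ for attacking $u,v$ and $\sigma(u)\ge\sigma(\mathrm{rt}(u))$ whenever $\mathrm{rt}(u)$ exists. Reading order: columns left to right (column $\lambda_1$ first), each column top to bottom. An inversion is a pair of attacking cells $(u,v)$, $u$ preceding $v$ in reading order, with $\sigma(u)<\sigma(v)$; $\mathrm{inv}(\sigma)$ counts them. $n(\lambda)=\sum_i(i-1)\lambda_i$ and $\mathrm{cinv}(\sigma)=n(\lambda)-\mathrm{inv}(\sigma)$. -}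

module Defs where

open import Data.Nat using (ℕ; zero; suc; _+_; _*_; _∸_; _≤_; _<_; _≡ᵇ_; _<ᵇ_; _≤ᵇ_)
open import Data.Bool using (Bool; true; false; _∧_; _∨_; not; if_then_else_)
open import Data.List using (List; []; _∷_; length; filter; concatMap; map; upTo)
open import Data.Nat.ListAction using (sum)
open import Relation.Nullary.Decidable using (T?)
open import Data.List.Relation.Unary.All using (All)
open import Data.List.Relation.Unary.Linked using (Linked)
open import Data.List.Membership.Propositional using (_∈_)
open import Data.Product using (_×_; _,_; proj₁; proj₂)
open import Data.Integer using (ℤ; +_; _-_)
open import Relation.Binary.PropositionalEquality using (_≡_; _≢_)
open import Relation.Nullary.Decidable using (Dec; yes; no)

record IsPartition (λs : List ℕ) : Set where
  field
    weaklyDecreasing : Linked (λ a b → b ≤ a) λs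
    positive         : All (λ a → 1 ≤ a) λs

-- λ_i for 1-indexed i (0 if i = 0 or i > ℓ(λ)).
part : List ℕ → ℕ → ℕ
part []       _             = 0
part (x ∷ xs) zero          = 0
part (x ∷ xs) (suc zero)    = x
part (x ∷ xs) (suc (suc i)) = part xs (suc i)

-- A cell (i , j): row i (1-indexed, downward), column j (1-indexed, column 1 rightmost).
Cell : Set
Cell = ℕ × ℕ

row col : Cell → ℕ
row = proj₁
col = proj₂

oneTo : ℕ → List ℕ
oneTo m = map suc (upTo m)

cells : List ℕ → List Cell
cells λs = concatMap (λ i → map (λ j → (i , j)) (oneTo (part λs i))) (oneTo (length λs))

isCellᵇ : List ℕ → Cell → Bool
isCellᵇ λs (i , j) = (1 ≤ᵇ i) ∧ (1 ≤ᵇ j) ∧ (j ≤ᵇ part λs i)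

_≟ᶜ_ : Cell → Cell → Bool
(i , j) ≟ᶜ (k , l) = (i ≡ᵇ k) ∧ (j ≡ᵇ l)

diagAttackᵇ : Cell → Cell → Bool
diagAttackᵇ (i , j) (k , l) = (2 ≤ᵇ j) ∧ (l ≡ᵇ j ∸ 1) ∧ (k <ᵇ i)

attacksᵇ : Cell → Cell → Bool
attacksᵇ u v = ((col u ≡ᵇ col v) ∧ not (u ≟ᶜ v)) ∨ diagAttackᵇ u v ∨ diagAttackᵇ v u

-- Reading order: columns left to right (larger column index first), each column top to bottom.
precedesᵇ : Cell → Cell → Bool
precedesᵇ (i , j) (k , l) = (l <ᵇ j) ∨ ((j ≡ᵇ l) ∧ (i <ᵇ k))

Filling : Set
Filling = Cell → ℕ

record InF (λs : List ℕ) (n : ℕ) (σ : Filling) : Set where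
  field
    range     : ∀ u → u ∈ cells λs → 1 ≤ σ u × σ u ≤ n
    nonattack : ∀ u v → u ∈ cells λs → v ∈ cells λs → attacksᵇ u v ≡ true → σ u ≢ σ v
    rowWeak   : ∀ i j → (i , suc (suc j)) ∈ cells λs → σ (i , suc j) ≤ σ (i , suc (suc j))

cellPairs : List ℕ → List (Cell × Cell)
cellPairs λs = concatMap (λ u → map (λ v → (u , v)) (cells λs)) (cells λs)

countᵇ : {A : Set} → (A → Bool) → List A → ℕ
countᵇ p xs = length (filter (λ x → T? (p x)) xs)

inv : List ℕ → Filling → ℕ
inv λs σ = countᵇ (λ p → attacksᵇ (proj₁ p) (proj₂ p) ∧ precedesᵇ (proj₁ p) (proj₂ p)
                         ∧ (σ (proj₁ p) <ᵇ σ (proj₂ p)))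
                  (cellPairs λs)

nλ : List ℕ → ℕ
nλ λs = sum (map (λ i → (i ∸ 1) * part λs i) (oneTo (length λs)))

cinv : List ℕ → Filling → ℤ
cinv λs σ = + nλ λs - + inv λs σ

goodPairᵇ : List ℕ → Filling → Cell × Cell → Bool
goodPairᵇ λs σ ((i , j) , (k , l)) =
  (j ≡ᵇ l) ∧ (k <ᵇ i) ∧ (σ (i , j) <ᵇ σ (k , l))
  ∧ (if isCellᵇ λs (i , suc j) then σ (k , l) <ᵇ σ (i , suc j) else true)

goodPairs : List ℕ → Filling → ℕ
goodPairs λs σ = countᵇ (goodPairᵇ λs σ) (cellPairs λs)

-- Write [P] for the 0/1 indicator of P and sum over ordered pairs of cells.  The
-- proof establishes  n(λ) = inv(σ) + #good  by splitting one double sum: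
--   (1) n(λ) = Σ_{u,v} [v lies strictly above u in its column], because in a
--       partition the cell (i , j) has exactly i - 1 cells above it;
--   (2) an attacking pair in reading order is either a pair in one column read top
--       to bottom or a diagonal attack, so inv(σ) = (column part) + (diagonal part);
--   (3) a diagonal attack (w , v) has a cell u directly to the right of w, so the
--       diagonal part may be re-indexed by u: Σ_{u,v} [w = left(u) is a cell] ·
--       [w attacks v diagonally, σ w < σ v];
--   (4) for v strictly above u with w = left(u), exactly one of  σ v < σ u,
--       "w exists and σ w < σ v", or "(u , v) is good" holds: non-attacking gives
--       σ u ≠ σ v and σ v ≠ σ w, and weakly increasing rows give σ u ≤ σ w.
module Submission where

open import Defs
open import Data.Bool using (Bool; true; false; _∧_; _∨_; not; if_then_else_; T)
open import Data.Bool.Properties using (∧-assoc; ∧-zeroʳ; ∧-identityʳ; T-≡; T-∧; T-∨)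
open import Data.Empty using (⊥; ⊥-elim)
open import Data.Integer using (+_; _-_; _⊖_)
open import Data.Integer.Properties using ([+m]-[+n]≡m⊖n; ⊖-≥)
open import Data.List using (List; []; _∷_; _++_; length; map; concatMap; upTo)
open import Data.List.Properties using (map-++; length-map; upTo-∷ʳ; map-upTo; length-upTo)
open import Data.List.Membership.Propositional using (_∈_)
open import Data.List.Membership.Propositional.Properties
  using (∈-map⁺; ∈-map⁻; ∈-concat⁺′; ∈-concat⁻′; ∈-upTo⁺; ∈-upTo⁻)
open import Data.List.Relation.Unary.Any using (here; there)
open import Data.List.Relation.Unary.Linked using (Linked; [-]; _∷_)
open import Data.Nat using (ℕ; zero; suc; _+_; _*_; _∸_; _≤_; _<_; _≡ᵇ_; _<ᵇ_; _≤ᵇ_; z≤n; s≤s)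
open import Data.Nat.ListAction using (sum)
open import Data.Nat.ListAction.Properties using (sum-++)
open import Data.Nat.Properties
open import Data.Product using (_×_; _,_; proj₁; proj₂)
open import Data.Sum using (inj₁; inj₂)
open import Function using (_∘_; Equivalence)
open import Relation.Binary.Definitions using (tri<; tri≈; tri>)
open import Relation.Binary.PropositionalEquality
open import Algebra.Properties.CommutativeSemigroup +-commutativeSemigroup using (interchange)
open ≡-Reasoning

𝟙 : Bool → ℕ
𝟙 true  = 1
𝟙 false = 0

∑ : {A : Set} → (A → ℕ) → List A → ℕ
∑ f xs = sum (map f xs)

count-as-∑ : {A : Set} (p : A → Bool) (xs : List A) → countᵇ p xs ≡ ∑ (𝟙 ∘ p) xs
count-as-∑ p [] = refl
count-as-∑ p (x ∷ xs) with p x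
... | true  = cong suc (count-as-∑ p xs)
... | false = count-as-∑ p xs

∑-++ : {A : Set} (f : A → ℕ) (xs ys : List A) → ∑ f (xs ++ ys) ≡ ∑ f xs + ∑ f ys
∑-++ f xs ys = trans (cong sum (map-++ f xs ys)) (sum-++ (map f xs) (map f ys))

∑-map : {A B : Set} (f : B → ℕ) (g : A → B) (xs : List A) → ∑ f (map g xs) ≡ ∑ (f ∘ g) xs
∑-map f g [] = refl
∑-map f g (x ∷ xs) = cong (_+_ (f (g x))) (∑-map f g xs)

∑-concatMap : {A B : Set} (f : B → ℕ) (g : A → List B) (xs : List A) →
  ∑ f (concatMap g xs) ≡ ∑ (λ x → ∑ f (g x)) xs
∑-concatMap f g [] = refl
∑-concatMap f g (x ∷ xs) =
  trans (∑-++ f (g x) (concatMap g xs)) (cong (_+_ (∑ f (g x))) (∑-concatMap f g xs))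

∑-cong : {A : Set} {f g : A → ℕ} (xs : List A) → (∀ x → x ∈ xs → f x ≡ g x) → ∑ f xs ≡ ∑ g xs
∑-cong [] h = refl
∑-cong (x ∷ xs) h = cong₂ _+_ (h x (here refl)) (∑-cong xs (λ y y∈xs → h y (there y∈xs)))

∑-+ : {A : Set} (f g : A → ℕ) (xs : List A) → ∑ (λ x → f x + g x) xs ≡ ∑ f xs + ∑ g xs
∑-+ f g [] = refl
∑-+ f g (x ∷ xs) = trans (cong (_+_ (f x + g x)) (∑-+ f g xs)) (interchange (f x) (g x) (∑ f xs) (∑ g xs))

∑-zero : {A : Set} (xs : List A) → ∑ (λ _ → 0) xs ≡ 0
∑-zero [] = refl
∑-zero (x ∷ xs) = ∑-zero xs

∑-const : {A : Set} (c : ℕ) (xs : List A) → ∑ (λ _ → c) xs ≡ length xs * c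
∑-const c [] = refl
∑-const c (x ∷ xs) = cong (_+_ c) (∑-const c xs)

∑-swap : {A B : Set} (f : A → B → ℕ) (xs : List A) (ys : List B) →
  ∑ (λ x → ∑ (f x) ys) xs ≡ ∑ (λ y → ∑ (λ x → f x y) xs) ys
∑-swap f [] ys = sym (∑-zero ys)
∑-swap f (x ∷ xs) ys =
  trans (cong (_+_ (∑ (f x) ys)) (∑-swap f xs ys)) (sym (∑-+ (f x) (λ y → ∑ (λ x′ → f x′ y) xs) ys))

oneTo-suc : ∀ m → oneTo (suc m) ≡ 1 ∷ map suc (oneTo m)
oneTo-suc m = cong (λ xs → 1 ∷ map suc xs) (sym (map-upTo suc m))

oneTo-snoc : ∀ m → oneTo (suc m) ≡ oneTo m ++ (suc m ∷ [])
oneTo-snoc m = trans (cong (map suc) (sym (upTo-∷ʳ m))) (map-++ suc (upTo m) (m ∷ []))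

length-oneTo : ∀ m → length (oneTo m) ≡ m
length-oneTo m = trans (length-map suc (upTo m)) (length-upTo m)

∈-oneTo⁻ : ∀ {m j} → j ∈ oneTo m → 1 ≤ j × j ≤ m
∈-oneTo⁻ j∈ with ∈-map⁻ suc j∈
... | i , i∈ , refl = s≤s z≤n , ∈-upTo⁻ i∈

∈-oneTo⁺ : ∀ {m i} → i < m → suc i ∈ oneTo m
∈-oneTo⁺ i<m = ∈-map⁺ suc (∈-upTo⁺ i<m)

∑-oneTo-suc : (f : ℕ → ℕ) (m : ℕ) → ∑ f (oneTo (suc m)) ≡ f 1 + ∑ (f ∘ suc) (oneTo m)
∑-oneTo-suc f m = trans (cong (∑ f) (oneTo-suc m)) (cong (_+_ (f 1)) (∑-map f suc (oneTo m)))

∑-oneTo-snoc : (f : ℕ → ℕ) (m : ℕ) → ∑ f (oneTo (suc m)) ≡ ∑ f (oneTo m) + f (suc m)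
∑-oneTo-snoc f m = begin
  ∑ f (oneTo (suc m))                  ≡⟨ cong (∑ f) (oneTo-snoc m) ⟩
  ∑ f (oneTo m ++ (suc m ∷ []))        ≡⟨ ∑-++ f (oneTo m) (suc m ∷ []) ⟩
  ∑ f (oneTo m) + (f (suc m) + 0)      ≡⟨ cong (_+_ (∑ f (oneTo m))) (+-identityʳ (f (suc m))) ⟩
  ∑ f (oneTo m) + f (suc m)            ∎

<ᵇ-true : ∀ {m n} → m < n → (m <ᵇ n) ≡ true
<ᵇ-true m<n = Equivalence.to T-≡ (<⇒<ᵇ m<n)

<ᵇ-false : ∀ {m n} → n ≤ m → (m <ᵇ n) ≡ false
<ᵇ-false {m} {zero} _ = refl
<ᵇ-false {suc m} {suc n} (s≤s n≤m) = <ᵇ-false n≤m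

≡ᵇ-refl : ∀ n → (n ≡ᵇ n) ≡ true
≡ᵇ-refl zero = refl
≡ᵇ-refl (suc n) = ≡ᵇ-refl n

≡ᵇ-sym : ∀ m n → (m ≡ᵇ n) ≡ (n ≡ᵇ m)
≡ᵇ-sym zero zero = refl
≡ᵇ-sym zero (suc n) = refl
≡ᵇ-sym (suc m) zero = refl
≡ᵇ-sym (suc m) (suc n) = ≡ᵇ-sym m n

≡ᵇ-false : ∀ {m n} → m ≢ n → (m ≡ᵇ n) ≡ false
≡ᵇ-false {m} {n} m≢n with m ≡ᵇ n in m≡ᵇn
... | true  = ⊥-elim (m≢n (≡ᵇ⇒≡ m n (Equivalence.from T-≡ m≡ᵇn)))
... | false = refl

∑-oneTo-below : ∀ ℓ i → i ≤ suc ℓ → ∑ (λ k → 𝟙 (k <ᵇ i)) (oneTo ℓ) ≡ i ∸ 1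
∑-oneTo-below zero i i≤1 = sym (m≤n⇒m∸n≡0 i≤1)
∑-oneTo-below (suc ℓ) zero _ = ∑-zero (oneTo (suc ℓ))
∑-oneTo-below (suc ℓ) (suc i) (s≤s i≤1+ℓ) =
  trans (∑-oneTo-suc (λ k → 𝟙 (k <ᵇ suc i)) ℓ)
        (trans (cong (_+_ (𝟙 (0 <ᵇ i))) (∑-oneTo-below ℓ i i≤1+ℓ)) (positive-part i))
  where
  positive-part : ∀ i → 𝟙 (0 <ᵇ i) + (i ∸ 1) ≡ i
  positive-part zero = refl
  positive-part (suc i) = refl

∑-oneTo-≡ᵇ : ∀ m j → j < m → ∑ (λ l → 𝟙 (l ≡ᵇ suc j)) (oneTo m) ≡ 1
∑-oneTo-≡ᵇ (suc m) zero _ =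
  trans (∑-oneTo-suc (λ l → 𝟙 (l ≡ᵇ 1)) m)
        (cong suc (trans (∑-map (λ l → 𝟙 (l ≡ᵇ 0)) suc (upTo m)) (∑-zero (upTo m))))
∑-oneTo-≡ᵇ (suc m) (suc j) (s≤s j<m) =
  trans (∑-oneTo-suc (λ l → 𝟙 (l ≡ᵇ suc (suc j))) m) (∑-oneTo-≡ᵇ m j j<m)

∑-oneTo-shift : ∀ m (f : ℕ → ℕ) → f 1 ≡ 0 →
  ∑ f (oneTo m) ≡ ∑ (λ j → if suc j ≤ᵇ m then f (suc j) else 0) (oneTo m)
∑-oneTo-shift zero f _ = refl
∑-oneTo-shift (suc m) f f1≡0 = begin
  ∑ f (oneTo (suc m))                           ≡⟨ ∑-oneTo-suc f m ⟩
  f 1 + ∑ (f ∘ suc) (oneTo m)                   ≡⟨ cong (_+ ∑ (f ∘ suc) (oneTo m)) f1≡0 ⟩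
  ∑ (f ∘ suc) (oneTo m)                         ≡⟨ ∑-cong (oneTo m) inside ⟩
  ∑ g (oneTo m)                                 ≡⟨ sym (+-identityʳ (∑ g (oneTo m))) ⟩
  ∑ g (oneTo m) + 0                             ≡⟨ cong (λ b → ∑ g (oneTo m) + (if b then f (suc (suc m)) else 0))
                                                        (sym (<ᵇ-false {m} {m} ≤-refl)) ⟩
  ∑ g (oneTo m) + g (suc m)                     ≡⟨ sym (∑-oneTo-snoc g m) ⟩
  ∑ g (oneTo (suc m))                           ∎
  where
  g : ℕ → ℕ
  g j = if suc j ≤ᵇ suc m then f (suc j) else 0
  inside : ∀ j → j ∈ oneTo m → f (suc j) ≡ g j
  inside j j∈ rewrite <ᵇ-true (s≤s (proj₂ (∈-oneTo⁻ j∈))) = refl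

∑-cells : (λs : List ℕ) (F : Cell → ℕ) →
  ∑ F (cells λs) ≡ ∑ (λ i → ∑ (λ j → F (i , j)) (oneTo (part λs i))) (oneTo (length λs))
∑-cells λs F =
  trans (∑-concatMap F (λ i → map (λ j → (i , j)) (oneTo (part λs i))) (oneTo (length λs)))
        (∑-cong (oneTo (length λs)) (λ i _ → ∑-map F (λ j → (i , j)) (oneTo (part λs i))))

record IsCell (λs : List ℕ) (u : Cell) : Set where
  field
    row≥1 : 1 ≤ row u
    row≤ℓ : row u ≤ length λs
    col≥1 : 1 ≤ col u
    col≤λ : col u ≤ part λs (row u)

cell⁻ : (λs : List ℕ) {u : Cell} → u ∈ cells λs → IsCell λs u
cell⁻ λs u∈ with ∈-concat⁻′ (map (λ i → map (λ j → (i , j)) (oneTo (part λs i))) (oneTo (length λs))) u∈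
... | _ , u∈row , row∈ with ∈-map⁻ (λ i → map (λ j → (i , j)) (oneTo (part λs i))) row∈
...   | i , i∈ , refl with ∈-map⁻ (λ j → (i , j)) u∈row
...     | j , j∈ , refl = record
  { row≥1 = proj₁ (∈-oneTo⁻ i∈) ; row≤ℓ = proj₂ (∈-oneTo⁻ i∈)
  ; col≥1 = proj₁ (∈-oneTo⁻ j∈) ; col≤λ = proj₂ (∈-oneTo⁻ j∈) }

cell⁺ : (λs : List ℕ) {i j : ℕ} → i < length λs → j < part λs (suc i) → (suc i , suc j) ∈ cells λs
cell⁺ λs {i} {j} i<ℓ j<λ = ∈-concat⁺′ (∈-map⁺ (λ j → (suc i , j)) (∈-oneTo⁺ j<λ))
  (∈-map⁺ (λ i → map (λ j → (i , j)) (oneTo (part λs i))) (∈-oneTo⁺ i<ℓ))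

part-head : ∀ {x xs} → Linked (λ a b → b ≤ a) (x ∷ xs) → ∀ i → part (x ∷ xs) (suc i) ≤ x
part-head L zero = ≤-refl
part-head [-] (suc i) = z≤n
part-head (y≤x ∷ L) (suc i) = ≤-trans (part-head L i) y≤x

part-decreasing : ∀ {xs} → Linked (λ a b → b ≤ a) xs → ∀ k i → k ≤ i → part xs (suc i) ≤ part xs (suc k)
part-decreasing {[]} L k i _ = z≤n
part-decreasing {x ∷ xs} L zero zero _ = ≤-refl
part-decreasing {x ∷ xs} L zero (suc i) _ = part-head L (suc i)
part-decreasing {x ∷ []} L (suc k) (suc i) _ = z≤n
part-decreasing {x ∷ y ∷ xs} (_ ∷ L) (suc k) (suc i) (s≤s k≤i) = part-decreasing L k i k≤i

part-antitone : {λs : List ℕ} → IsPartition λs → ∀ {k i} → 1 ≤ k → k ≤ i → part λs i ≤ part λs k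
part-antitone P {suc k} {suc i} _ (s≤s k≤i) = part-decreasing (IsPartition.weaklyDecreasing P) k i k≤i

aboveᵇ : Cell → Cell → Bool
aboveᵇ (k , l) (i , j) = (l ≡ᵇ j) ∧ (k <ᵇ i)

cells-above : (λs : List ℕ) → IsPartition λs → ∀ u → IsCell λs u →
  ∑ (λ v → 𝟙 (aboveᵇ v u)) (cells λs) ≡ row u ∸ 1
cells-above λs P (suc i , suc j) c@record { row≥1 = s≤s z≤n ; col≥1 = s≤s z≤n } = begin
  ∑ (λ v → 𝟙 (aboveᵇ v u)) (cells λs)                                     ≡⟨ ∑-cells λs _ ⟩
  ∑ (λ k → ∑ (λ l → 𝟙 (aboveᵇ (k , l) u)) (oneTo (part λs k))) (oneTo ℓ)  ≡⟨ ∑-cong (oneTo ℓ) row-k ⟩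
  ∑ (λ k → 𝟙 (k <ᵇ suc i)) (oneTo ℓ)                                      ≡⟨ ∑-oneTo-below ℓ (suc i) (m≤n⇒m≤1+n (IsCell.row≤ℓ c)) ⟩
  i                                                                       ∎
  where
  u = (suc i , suc j)
  ℓ = length λs
  -- a row above u meets u's column in exactly one cell, a lower row in none
  row-k : ∀ k → k ∈ oneTo ℓ → ∑ (λ l → 𝟙 (aboveᵇ (k , l) u)) (oneTo (part λs k)) ≡ 𝟙 (k <ᵇ suc i)
  row-k k k∈ with k <ᵇ suc i in k<u
  ... | false = trans (∑-cong (oneTo (part λs k)) (λ l _ → cong 𝟙 (∧-zeroʳ (l ≡ᵇ suc j))))
                      (∑-zero (oneTo (part λs k)))
  ... | true = trans (∑-cong (oneTo (part λs k)) (λ l _ → cong 𝟙 (∧-identityʳ (l ≡ᵇ suc j))))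
                     (∑-oneTo-≡ᵇ (part λs k) j (<-≤-trans (IsCell.col≤λ c)
                        (part-antitone P (proj₁ (∈-oneTo⁻ k∈)) (<⇒≤ (<ᵇ⇒< k (suc i) (Equivalence.from T-≡ k<u))))))

n-as-pairs : (λs : List ℕ) → IsPartition λs →
  nλ λs ≡ ∑ (λ u → ∑ (λ v → 𝟙 (aboveᵇ v u)) (cells λs)) (cells λs)
n-as-pairs λs P = sym (begin
  ∑ (λ u → ∑ (λ v → 𝟙 (aboveᵇ v u)) (cells λs)) (cells λs)   ≡⟨ ∑-cells λs _ ⟩
  ∑ (λ i → ∑ (λ j → ∑ (λ v → 𝟙 (aboveᵇ v (i , j))) (cells λs)) (oneTo (part λs i))) (oneTo ℓ)
                                                           ≡⟨ ∑-cong (oneTo ℓ) row-i ⟩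
  ∑ (λ i → (i ∸ 1) * part λs i) (oneTo ℓ)                  ∎)
  where
  ℓ = length λs
  row-i : ∀ i → i ∈ oneTo ℓ →
    ∑ (λ j → ∑ (λ v → 𝟙 (aboveᵇ v (i , j))) (cells λs)) (oneTo (part λs i)) ≡ (i ∸ 1) * part λs i
  row-i i i∈ = begin
    ∑ (λ j → ∑ (λ v → 𝟙 (aboveᵇ v (i , j))) (cells λs)) (oneTo (part λs i))
      ≡⟨ ∑-cong (oneTo (part λs i)) (λ j j∈ → cells-above λs P (i , j) (record
           { row≥1 = proj₁ (∈-oneTo⁻ i∈) ; row≤ℓ = proj₂ (∈-oneTo⁻ i∈)
           ; col≥1 = proj₁ (∈-oneTo⁻ j∈) ; col≤λ = proj₂ (∈-oneTo⁻ j∈) })) ⟩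
    ∑ (λ _ → i ∸ 1) (oneTo (part λs i))        ≡⟨ ∑-const (i ∸ 1) (oneTo (part λs i)) ⟩
    length (oneTo (part λs i)) * (i ∸ 1)       ≡⟨ cong (_* (i ∸ 1)) (length-oneTo (part λs i)) ⟩
    part λs i * (i ∸ 1)                        ≡⟨ *-comm (part λs i) (i ∸ 1) ⟩
    (i ∸ 1) * part λs i                        ∎

diag⇒col< : ∀ u v → T (diagAttackᵇ u v) → col v < col u
diag⇒col< (i , suc (suc j)) (k , l) d with ≡ᵇ⇒≡ l (suc j) (proj₁ (Equivalence.to T-∧ d))
... | refl = ≤-refl

-- The propositional shape of "attacking and in reading order" for cells u, v, where
-- e: same column, d₁/d₂: u attacks v / v attacks u diagonally, lt: v right of u,
-- ieq/ilt: row u = / < row v.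
in-order-tautology : ∀ e d₁ d₂ lt ieq ilt →
  (T d₁ → T lt) → (T d₂ → T lt → ⊥) → (T e → T lt → ⊥) → (T ieq → T ilt → ⊥) →
  ((e ∧ not (ieq ∧ e)) ∨ d₁ ∨ d₂) ∧ (lt ∨ (e ∧ ilt)) ≡ (e ∧ ilt) ∨ d₁
in-order-tautology true  true  _     _     _     _     h₁ _  h₃ _  = ⊥-elim (h₃ _ (h₁ _))
in-order-tautology true  false _     true  _     _     _  _  h₃ _  = ⊥-elim (h₃ _ _)
in-order-tautology true  false _     false true  true  _  _  _  h₄ = ⊥-elim (h₄ _ _)
in-order-tautology true  false true  false true  false _  _  _  _  = refl
in-order-tautology true  false false false true  false _  _  _  _  = refl
in-order-tautology true  false true  false false true  _  _  _  _  = refl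
in-order-tautology true  false false false false true  _  _  _  _  = refl
in-order-tautology true  false true  false false false _  _  _  _  = refl
in-order-tautology true  false false false false false _  _  _  _  = refl
in-order-tautology false true  _     true  _     _     _  _  _  _  = refl
in-order-tautology false true  _     false _     _     h₁ _  _  _  = ⊥-elim (h₁ _)
in-order-tautology false false false _     _     _     _  _  _  _  = refl
in-order-tautology false false true  true  _     _     _  h₂ _  _  = ⊥-elim (h₂ _ _)
in-order-tautology false false true  false _     _     _  _  _  _  = refl

attacking-in-order : ∀ u v → attacksᵇ u v ∧ precedesᵇ u v ≡ aboveᵇ u v ∨ diagAttackᵇ u v
attacking-in-order (i , j) (k , l) =
  in-order-tautology (j ≡ᵇ l) (diagAttackᵇ (i , j) (k , l)) (diagAttackᵇ (k , l) (i , j))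
    (l <ᵇ j) (i ≡ᵇ k) (i <ᵇ k) u→v v→u same-col same-row
  where
  u→v : T (diagAttackᵇ (i , j) (k , l)) → T (l <ᵇ j)
  u→v d = <⇒<ᵇ (diag⇒col< (i , j) (k , l) d)
  v→u : T (diagAttackᵇ (k , l) (i , j)) → T (l <ᵇ j) → ⊥
  v→u d l<j = <-asym (diag⇒col< (k , l) (i , j) d) (<ᵇ⇒< l j l<j)
  same-col : T (j ≡ᵇ l) → T (l <ᵇ j) → ⊥
  same-col j≡l l<j = <-irrefl (sym (≡ᵇ⇒≡ j l j≡l)) (<ᵇ⇒< l j l<j)
  same-row : T (i ≡ᵇ k) → T (i <ᵇ k) → ⊥
  same-row i≡k i<k = <-irrefl (≡ᵇ⇒≡ i k i≡k) (<ᵇ⇒< i k i<k)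

above-not-diag : ∀ u v → T (aboveᵇ u v) → T (diagAttackᵇ u v) → ⊥
above-not-diag (i , j) (k , l) a d =
  <-irrefl (sym (≡ᵇ⇒≡ j l (proj₁ (Equivalence.to T-∧ a)))) (diag⇒col< (i , j) (k , l) d)

𝟙-disjoint-∨ : ∀ a b s → (T a → T b → ⊥) → 𝟙 ((a ∨ b) ∧ s) ≡ 𝟙 (a ∧ s) + 𝟙 (b ∧ s)
𝟙-disjoint-∨ true  true  s a∩b = ⊥-elim (a∩b _ _)
𝟙-disjoint-∨ true  false s _   = sym (+-identityʳ (𝟙 s))
𝟙-disjoint-∨ false b     s _   = refl

inversion-kinds : ∀ u v s →
  𝟙 (attacksᵇ u v ∧ precedesᵇ u v ∧ s) ≡ 𝟙 (aboveᵇ u v ∧ s) + 𝟙 (diagAttackᵇ u v ∧ s)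
inversion-kinds u v s = begin
  𝟙 (attacksᵇ u v ∧ precedesᵇ u v ∧ s)        ≡⟨ cong 𝟙 (sym (∧-assoc (attacksᵇ u v) (precedesᵇ u v) s)) ⟩
  𝟙 ((attacksᵇ u v ∧ precedesᵇ u v) ∧ s)      ≡⟨ cong (λ b → 𝟙 (b ∧ s)) (attacking-in-order u v) ⟩
  𝟙 ((aboveᵇ u v ∨ diagAttackᵇ u v) ∧ s)      ≡⟨ 𝟙-disjoint-∨ (aboveᵇ u v) (diagAttackᵇ u v) s (above-not-diag u v) ⟩
  𝟙 (aboveᵇ u v ∧ s) + 𝟙 (diagAttackᵇ u v ∧ s) ∎

trichotomy : ∀ c x y z → x ≢ y → (T c → y ≢ z × x ≤ z) →
  𝟙 (y <ᵇ x) + (if c then 𝟙 (z <ᵇ y) else 0) + 𝟙 ((x <ᵇ y) ∧ (if c then y <ᵇ z else true)) ≡ 1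
trichotomy false x y z x≢y _ with <-cmp x y
... | tri< x<y _ _ rewrite <ᵇ-true x<y | <ᵇ-false (<⇒≤ x<y) = refl
... | tri≈ _ x≡y _ = ⊥-elim (x≢y x≡y)
... | tri> _ _ y<x rewrite <ᵇ-true y<x | <ᵇ-false (<⇒≤ y<x) = refl
trichotomy true x y z x≢y w with <-cmp x y | <-cmp y z
... | tri≈ _ x≡y _ | _ = ⊥-elim (x≢y x≡y)
... | _ | tri≈ _ y≡z _ = ⊥-elim (proj₁ (w _) y≡z)
... | tri< x<y _ _ | tri< y<z _ _
  rewrite <ᵇ-true x<y | <ᵇ-false (<⇒≤ x<y) | <ᵇ-true y<z | <ᵇ-false (<⇒≤ y<z) = refl
... | tri< x<y _ _ | tri> _ _ z<y
  rewrite <ᵇ-true x<y | <ᵇ-false (<⇒≤ x<y) | <ᵇ-true z<y | <ᵇ-false (<⇒≤ z<y) = refl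
... | tri> _ _ y<x | tri< y<z _ _
  rewrite <ᵇ-true y<x | <ᵇ-false (<⇒≤ y<x) | <ᵇ-false (<⇒≤ y<z) = refl
... | tri> _ _ y<x | tri> _ _ z<y = ⊥-elim (<-asym z<y (<-≤-trans y<x (proj₂ (w _))))

gated-trichotomy : ∀ a c x y z → (T a → x ≢ y) → (T a → T c → y ≢ z × x ≤ z) →
  𝟙 a ≡ 𝟙 (a ∧ (y <ᵇ x)) + (if c then 𝟙 (a ∧ (z <ᵇ y)) else 0)
        + 𝟙 (a ∧ (x <ᵇ y) ∧ (if c then y <ᵇ z else true))
gated-trichotomy false false x y z _ _ = refl
gated-trichotomy false true  x y z _ _ = refl
gated-trichotomy true  c     x y z h₁ h₂ = sym (trichotomy c x y z (h₁ _) (h₂ _))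

+[m+n]-+m : ∀ m n → + (m + n) - + m ≡ + n
+[m+n]-+m m n = begin
  + (m + n) - + m   ≡⟨ [+m]-[+n]≡m⊖n (m + n) m ⟩
  (m + n) ⊖ m       ≡⟨ ⊖-≥ (m≤m+n m n) ⟩
  + (m + n ∸ m)     ≡⟨ cong +_ (m+n∸m≡n m n) ⟩
  + n               ∎

leftOf : Cell → Cell
leftOf (i , j) = (i , suc j)

hasLeftᵇ : List ℕ → Cell → Bool
hasLeftᵇ λs (i , j) = suc j ≤ᵇ part λs i

goodPair-above : ∀ λs σ i j v → goodPairᵇ λs σ ((suc i , j) , v) ≡
  aboveᵇ v (suc i , j) ∧ ((σ (suc i , j) <ᵇ σ v)
    ∧ (if hasLeftᵇ λs (suc i , j) then σ v <ᵇ σ (leftOf (suc i , j)) else true))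
goodPair-above λs σ i j (k , l) =
  trans (cong (_∧ ((k <ᵇ suc i) ∧ rest)) (≡ᵇ-sym j l)) (sym (∧-assoc (l ≡ᵇ j) (k <ᵇ suc i) rest))
  where
  rest : Bool
  rest = (σ (suc i , j) <ᵇ σ (k , l))
    ∧ (if hasLeftᵇ λs (suc i , j) then σ (k , l) <ᵇ σ (suc i , suc j) else true)

module Counting (λs : List ℕ) (σ : Filling) where

  cs : List Cell
  cs = cells λs

  ∑² : (Cell → Cell → ℕ) → ℕ
  ∑² F = ∑ (λ u → ∑ (F u) cs) cs

  ∑-cellPairs : (F : Cell × Cell → ℕ) → ∑ F (cellPairs λs) ≡ ∑² (λ u v → F (u , v))
  ∑-cellPairs F = trans (∑-concatMap F (λ u → map (λ v → (u , v)) cs) cs)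
    (∑-cong cs (λ u _ → ∑-map F (λ v → (u , v)) cs))

  ∑²-+ : (F G : Cell → Cell → ℕ) → ∑² (λ u v → F u v + G u v) ≡ ∑² F + ∑² G
  ∑²-+ F G = trans (∑-cong cs (λ u _ → ∑-+ (F u) (G u) cs)) (∑-+ (λ u → ∑ (F u) cs) (λ u → ∑ (G u) cs) cs)

  ∑²-cong : {F G : Cell → Cell → ℕ} → (∀ u v → u ∈ cs → v ∈ cs → F u v ≡ G u v) → ∑² F ≡ ∑² G
  ∑²-cong F≡G = ∑-cong cs (λ u u∈ → ∑-cong cs (λ v v∈ → F≡G u v u∈ v∈))

  colInv diagInv diagInvʳ good : Cell → Cell → ℕ
  colInv u v = 𝟙 (aboveᵇ u v ∧ (σ u <ᵇ σ v))
  diagInv u v = 𝟙 (diagAttackᵇ u v ∧ (σ u <ᵇ σ v))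
  diagInvʳ u v = if hasLeftᵇ λs u then diagInv (leftOf u) v else 0
  good u v = 𝟙 (goodPairᵇ λs σ (u , v))

  inv-split : inv λs σ ≡ ∑² colInv + ∑² diagInv
  inv-split = begin
    inv λs σ                                  ≡⟨ count-as-∑ _ (cellPairs λs) ⟩
    ∑ _ (cellPairs λs)                        ≡⟨ ∑-cellPairs _ ⟩
    ∑² (λ u v → 𝟙 (attacksᵇ u v ∧ precedesᵇ u v ∧ (σ u <ᵇ σ v)))
                                              ≡⟨ ∑²-cong (λ u v _ _ → inversion-kinds u v (σ u <ᵇ σ v)) ⟩
    ∑² (λ u v → colInv u v + diagInv u v)     ≡⟨ ∑²-+ colInv diagInv ⟩
    ∑² colInv + ∑² diagInv                    ∎

  good-as-∑² : goodPairs λs σ ≡ ∑² good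
  good-as-∑² = trans (count-as-∑ _ (cellPairs λs)) (∑-cellPairs _)

  diag-reindex : ∑² diagInv ≡ ∑² diagInvʳ
  diag-reindex = begin
    ∑² diagInv                          ≡⟨ ∑-swap diagInv cs cs ⟩
    ∑ (λ v → ∑ (λ u → diagInv u v) cs) cs ≡⟨ ∑-cong cs (λ v _ → by-rows v) ⟩
    ∑ (λ v → ∑ (λ u → diagInvʳ u v) cs) cs ≡⟨ sym (∑-swap diagInvʳ cs cs) ⟩
    ∑² diagInvʳ                         ∎
    where
    -- in each row, the cell in column 1 attacks nothing diagonally
    by-rows : ∀ v → ∑ (λ u → diagInv u v) cs ≡ ∑ (λ u → diagInvʳ u v) cs
    by-rows v = trans (∑-cells λs (λ u → diagInv u v)) (trans
      (∑-cong (oneTo (length λs)) (λ i _ → ∑-oneTo-shift (part λs i) (λ j → diagInv (i , j) v) refl))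
      (sym (∑-cells λs (λ u → diagInvʳ u v))))

  pointwise : ∀ {n} → InF λs n σ → ∀ u v → u ∈ cs → v ∈ cs →
    𝟙 (aboveᵇ v u) ≡ colInv v u + diagInvʳ u v + good u v
  pointwise F (_ , _) (k , l) u∈ v∈ with cell⁻ λs u∈
  ... | record { row≥1 = s≤s {n = i′} z≤n ; row≤ℓ = i≤ℓ ; col≥1 = s≤s {n = j′} z≤n } =
    trans (gated-trichotomy (aboveᵇ v u) (hasLeftᵇ λs u) (σ u) (σ v) (σ w) u≢v w-facts)
          (cong (_+_ (colInv v u + diagInvʳ u v)) (cong 𝟙 (sym (goodPair-above λs σ i′ (suc j′) v))))
    where
    u v w : Cell
    u = (suc i′ , suc j′)
    v = (k , l)
    w = leftOf u
    column-attack : T (aboveᵇ v u) → attacksᵇ u v ≡ true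
    column-attack a with ≡ᵇ⇒≡ l (suc j′) (proj₁ (Equivalence.to T-∧ a))
    ... | refl rewrite ≡ᵇ-refl j′
                     | ≡ᵇ-false {suc i′} {k} (>⇒≢ (<ᵇ⇒< k (suc i′) (proj₂ (Equivalence.to T-∧ a)))) = refl
    u≢v : T (aboveᵇ v u) → σ u ≢ σ v
    u≢v a = InF.nonattack F u v u∈ v∈ (column-attack a)
    w-facts : T (aboveᵇ v u) → T (hasLeftᵇ λs u) → σ v ≢ σ w × σ u ≤ σ w
    w-facts a c = (λ v≡w → InF.nonattack F w v w∈ v∈ w-attacks (sym v≡w)) , InF.rowWeak F (suc i′) j′ w∈
      where
      w∈ : w ∈ cs
      w∈ = cell⁺ λs i≤ℓ (≤ᵇ⇒≤ (suc (suc j′)) (part λs (suc i′)) c)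
      -- the diagonal attack of w on v is literally "v above u"
      w-attacks : attacksᵇ w v ≡ true
      w-attacks = Equivalence.to T-≡
        (Equivalence.from (T-∨ {x = (suc (suc j′) ≡ᵇ l) ∧ not (w ≟ᶜ v)})
          (inj₂ (Equivalence.from (T-∨ {y = diagAttackᵇ v w}) (inj₁ a))))

  n-split : IsPartition λs → ∀ {n} → InF λs n σ → nλ λs ≡ inv λs σ + goodPairs λs σ
  n-split P F = begin
    nλ λs                                                      ≡⟨ n-as-pairs λs P ⟩
    ∑² (λ u v → 𝟙 (aboveᵇ v u))                                ≡⟨ ∑²-cong (pointwise F) ⟩
    ∑² (λ u v → colInv v u + diagInvʳ u v + good u v)          ≡⟨ ∑²-+ _ good ⟩
    ∑² (λ u v → colInv v u + diagInvʳ u v) + ∑² good           ≡⟨ cong (_+ ∑² good) (∑²-+ (λ u v → colInv v u) diagInvʳ) ⟩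
    ∑² (λ u v → colInv v u) + ∑² diagInvʳ + ∑² good            ≡⟨ cong (λ t → t + ∑² diagInvʳ + ∑² good) (sym (∑-swap colInv cs cs)) ⟩
    ∑² colInv + ∑² diagInvʳ + ∑² good                          ≡⟨ cong (λ t → ∑² colInv + t + ∑² good) (sym diag-reindex) ⟩
    ∑² colInv + ∑² diagInv + ∑² good                           ≡⟨ cong₂ _+_ (sym inv-split) (sym good-as-∑²) ⟩
    inv λs σ + goodPairs λs σ                                  ∎

proposition2p12 : (λs : List ℕ) → IsPartition λs → (n : ℕ) → (σ : Filling) → InF λs n σ →
    cinv λs σ ≡ + goodPairs λs σ
proposition2p12 λs P n σ F = begin
  + nλ λs - + inv λs σ                           ≡⟨ cong (λ m → + m - + inv λs σ) (Counting.n-split λs σ P F) ⟩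
  + (inv λs σ + goodPairs λs σ) - + inv λs σ     ≡⟨ +[m+n]-+m (inv λs σ) (goodPairs λs σ) ⟩
  + goodPairs λs σ                               ∎
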